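{- Let $i=i_0i_1i_2\cdots$ be an interaction sequence. If $m\neq i_n$ for every $n>m$ (in the domain of $i$), then the interval $[i_m,m]$ is isolated. In particular, if $i$ has depth at most $\nu$ and $m$ has depth $\nu$, then $[i_m,m]$ is isolated.
   Context: A pointer sequence is a finite or infinite sequence $i_0i_1i_2\cdots$ of natural numbers with $i_0=0$ and $i_{n+1}<n+1$; its domain is the set of indices $\{0,1,\dots\}$. It is an interaction sequence if $i_{n+1}\in V(n+1)$ for all $n$, where $V(0)=\emptyset$ and $V(n+1)=\{n\}\cup V(i_n)$. A set $I$ of indices is isolated if for all $n$ in the domain, $i_n\in I$ implies $n\in I$. An interval of $i$ is a set of the form $[i_m,m]=\{k\mid i_m\le k\le m\}$. An index $m$ has depth $\nu$ if the sequence $m,\ i_m,\ i_{i_m},\ldots,0$ (iterating until $0$) has length $\nu+1$; $i$ has depth at most $\nu$ if every index has depth at most $\nu$. -}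

module Defs where

open import Data.Nat using (ℕ; zero; suc; _≤_; _<_)
open import Data.Unit using (⊤)
open import Data.Product using (_×_)
open import Relation.Binary.PropositionalEquality using (_≡_)

data Length : Set where
  fin : ℕ → Length
  inf : Length

_∈Dom_ : ℕ → Length → Set
n ∈Dom fin N = n < N
n ∈Dom inf   = ⊤

-- A pointer sequence: entries i n for n in the domain (values outside the
-- domain are irrelevant), with i₀ = 0 and i_{n+1} < n+1.
record PointerSeq : Set where
  field
    len    : Length
    ptr    : ℕ → ℕ
    ptr0   : 0 ∈Dom len → ptr 0 ≡ 0
    ptrLt  : ∀ n → suc n ∈Dom len → ptr (suc n) < suc n
open PointerSeq public

-- k ∈ V(n), where V(0) = ∅ and V(n+1) = {n} ∪ V(i_n)  (least such sets).
data InV (i : ℕ → ℕ) : ℕ → ℕ → Set where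
  here  : ∀ {n} → InV i (suc n) n
  there : ∀ {n k} → InV i (i n) k → InV i (suc n) k

IsInteractionSeq : PointerSeq → Set
IsInteractionSeq s = ∀ n → suc n ∈Dom len s → InV (ptr s) (suc n) (ptr s (suc n))

Isolated : PointerSeq → (ℕ → Set) → Set
Isolated s I = ∀ n → n ∈Dom len s → I (ptr s n) → I n

Interval : PointerSeq → ℕ → ℕ → Set
Interval s m k = ptr s m ≤ k × k ≤ m

-- Depth m ν : the chain m, i_m, i_{i_m}, …, 0 has length ν+1.
data Depth (i : ℕ → ℕ) : ℕ → ℕ → Set where
  d0 : Depth i 0 0
  dS : ∀ {m ν} → Depth i (i (suc m)) ν → Depth i (suc m) (suc ν)

DepthAtMost : PointerSeq → ℕ → Set
DepthAtMost s ν = ∀ n μ → n ∈Dom len s → Depth (ptr s) n μ → μ ≤ ν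

-- By strong induction on
-- j > m, nothing visible from j lies in [i_m, m): the newest entry j - 1 is
-- at least m, and otherwise we jump to V(i_{j-1}); either j - 1 = m and we land
-- below i_m, or i_{j-1} is visible from j - 1, hence (inductively) either below
-- i_m or above m (it cannot equal m), and we continue from there. Since
-- i_n ∈ V(n), a pointer i_n ∈ [i_m, m] with n > m is therefore impossible.
-- For the depth statement: if m = i_n then n has depth one more than m.
module Submission where

open import Defs
open import Data.Nat using (ℕ; zero; suc; _<_; _≤_; z≤n; s≤s)
open import Data.Nat.Properties
open import Data.Nat.Induction using (<-wellFounded)
open import Induction.WellFounded using (Acc; acc)
open import Data.Product using (_×_; _,_)
open import Data.Sum using (_⊎_; inj₁; inj₂)
open import Data.Unit using (tt)
open import Relation.Nullary using (contradiction)
open import Relation.Binary.PropositionalEquality using (_≡_; _≢_; sym; subst)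

∈Dom-downClosed : ∀ {a b} L → a ≤ b → b ∈Dom L → a ∈Dom L
∈Dom-downClosed (fin N) a≤b b<N = ≤-<-trans a≤b b<N
∈Dom-downClosed inf     _   _   = tt

NeverPointedLater : PointerSeq → ℕ → Set
NeverPointedLater s m = ∀ n → n ∈Dom len s → m < n → m ≢ ptr s n

module _ (s : PointerSeq) where

  ptr≤ : ∀ n → n ∈Dom len s → ptr s n ≤ n
  ptr≤ zero    d rewrite ptr0 s d = z≤n
  ptr≤ (suc n) d = <⇒≤ (ptrLt s n d)

  pred∈Dom : ∀ {n} → suc n ∈Dom len s → n ∈Dom len s
  pred∈Dom {n} = ∈Dom-downClosed (len s) (n≤1+n n)

  ptr∈Dom : ∀ n → n ∈Dom len s → ptr s n ∈Dom len s
  ptr∈Dom n d = ∈Dom-downClosed (len s) (ptr≤ n d) d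

  InV⇒< : ∀ {j k} → j ∈Dom len s → InV (ptr s) j k → k < j
  InV⇒< _  here = ≤-refl
  InV⇒< dj (there {n} v) = <-≤-trans (InV⇒< (ptr∈Dom n dn) v) (m≤n⇒m≤1+n (ptr≤ n dn))
    where dn = pred∈Dom dj

  ptr∈V : IsInteractionSeq s → ∀ {n} → n ∈Dom len s → 0 < n → InV (ptr s) n (ptr s n)
  ptr∈V int {suc n} d _ = int n d

  Depth-ptr : ∀ {m ν n} → Depth (ptr s) m ν → m ≡ ptr s n → 0 < n → Depth (ptr s) n (suc ν)
  Depth-ptr {ν = ν} {n = suc n} dm m≡ _ = dS (subst (λ x → Depth (ptr s) x ν) m≡ dm)

  maxDepth⇒neverPointedLater : ∀ {ν m} → DepthAtMost s ν → Depth (ptr s) m ν →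
                               NeverPointedLater s m
  maxDepth⇒neverPointedLater {ν} dam dm n dn m<n m≡ =
    1+n≰n (dam n (suc ν) dn (Depth-ptr dm m≡ (≤-<-trans z≤n m<n)))

  module _ (int : IsInteractionSeq s) {m : ℕ} (never : NeverPointedLater s m) where

    InV-skips-interval : ∀ {j k} → Acc _<_ j → j ∈Dom len s → m < j →
                         InV (ptr s) j k → m ≤ k ⊎ k < ptr s m
    InV-skips-interval _ _ m<j here = inj₁ (≤-pred m<j)
    InV-skips-interval (acc rec) dj m<j (there {n} {k} v) = byCases (m≤n⇒m<n∨m≡n (≤-pred m<j))
      where
        dn : n ∈Dom len s
        dn = pred∈Dom dj

        k<ptrn : k < ptr s n
        k<ptrn = InV⇒< (ptr∈Dom n dn) v

        fromPtr : m < n → m ≤ ptr s n ⊎ ptr s n < ptr s m → m ≤ k ⊎ k < ptr s m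
        fromPtr m<n (inj₁ m≤ptrn) = InV-skips-interval (rec (s≤s (ptr≤ n dn))) (ptr∈Dom n dn)
                                      (≤∧≢⇒< m≤ptrn (never n dn m<n)) v
        fromPtr _   (inj₂ ptrn<ptrm) = inj₂ (<-trans k<ptrn ptrn<ptrm)

        byCases : m < n ⊎ m ≡ n → m ≤ k ⊎ k < ptr s m
        byCases (inj₁ m<n) = fromPtr m<n (InV-skips-interval (rec ≤-refl) dn m<n
                                        (ptr∈V int dn (≤-<-trans z≤n m<n)))
        byCases (inj₂ m≡n) = inj₂ (subst (λ x → k < ptr s x) (sym m≡n) k<ptrn)

    neverPointedLater⇒isolated : Isolated s (Interval s m)
    neverPointedLater⇒isolated n dn (ptrm≤ptrn , ptrn≤m) with ≤-<-connex n m
    ... | inj₁ n≤m = ≤-trans ptrm≤ptrn (ptr≤ n dn) , n≤m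
    ... | inj₂ m<n
      with InV-skips-interval (<-wellFounded n) dn m<n (ptr∈V int dn (≤-<-trans z≤n m<n))
    ...   | inj₁ m≤ptrn  = contradiction (≤-antisym m≤ptrn ptrn≤m) (never n dn m<n)
    ...   | inj₂ ptrn<ptrm = contradiction ptrm≤ptrn (<⇒≱ ptrn<ptrm)

mainTheorem11 : (s : PointerSeq) → IsInteractionSeq s →
    ((m : ℕ) → m ∈Dom len s →
      ((n : ℕ) → n ∈Dom len s → m < n → m ≢ ptr s n) →
      Isolated s (Interval s m))
    × ((ν m : ℕ) → DepthAtMost s ν → m ∈Dom len s → Depth (ptr s) m ν →
      Isolated s (Interval s m))
mainTheorem11 s int =
  (λ m _ never → neverPointedLater⇒isolated s int never) ,
  (λ ν m dam _ dm → neverPointedLater⇒isolated s int (maxDepth⇒neverPointedLater s dam dm))
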